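{- Let $(s_n)_{n\ge1}$ be the Look-Knave sequence and let $r_\ell$ be as defined below. For every $\ell\ge1$, the strings $s_{\ell+1}$ and $s_{\ell+3}$ have the same first $|r_\ell|$ bits.
   Context: For a positive integer $m$, let $[m]$ denote the binary representation of $m$, with no leading zeros. For a finite binary string $s$, write $s=r_1r_2\cdots r_t$ as a concatenation of maximal runs: each $r_i$ is a nonempty block of a single repeated bit $b_i$, and consecutive runs use different bits. Define $$k(s)=[|r_1|]\,\overline{b_1}\cdots[|r_t|]\,\overline{b_t},$$ where $\overline{b}$ is the complement of $b$. The Look-Knave sequence is given by $s_1=1$ and $s_n=k(s_{n-1})$ for $n\ge2$. For $\ell\ge1$, let $r_\ell$ be the prefix of $s_\ell$ obtained as follows. Take the first $\ell$ bits of $s_\ell$. Then extend this prefix to the end of the maximal run of $s_\ell$ containing its last bit. For example, $s_3=1011$ gives $r_3=1011$. -}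

module Defs where

open import Data.Bool using (Bool; true; false; not; if_then_else_)
open import Data.Nat using (ℕ; zero; suc; _+_; _≤ᵇ_)
open import Data.Nat.Binary using (ℕᵇ; 2[1+_]; 1+[2_])
import Data.Nat.Binary as B
open import Data.List using (List; []; _∷_; _++_; length; reverse; take; concatMap)
open import Data.Product using (_×_; _,_)

_≡ᵇ_ : Bool → Bool → Bool
true ≡ᵇ true = true
false ≡ᵇ false = true
_ ≡ᵇ _ = false

-- Bit strings are lists of bits; true = 1, false = 0.
BitString : Set
BitString = List Bool

-- Run-length decomposition: a list of maximal runs (b , n) meaning
-- the bit b repeated n times (n ≥ 1).
runs : BitString → List (Bool × ℕ)
runs [] = []
runs (b ∷ s) with runs s
... | [] = (b , 1) ∷ []
... | (c , n) ∷ rs = if b ≡ᵇ c then (c , suc n) ∷ rs else (b , 1) ∷ (c , n) ∷ rs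

-- Binary digits of a ℕᵇ, least significant first.
incLE : List Bool → List Bool
incLE [] = true ∷ []
incLE (false ∷ bs) = true ∷ bs
incLE (true ∷ bs) = false ∷ incLE bs

bitsLE : ℕᵇ → List Bool
bitsLE B.zero = []
bitsLE 2[1+ x ] = false ∷ incLE (bitsLE x)
bitsLE 1+[2 x ] = true ∷ bitsLE x

-- [m]: binary representation of m, most significant bit first,
-- no leading zeros (for m ≥ 1).
toBinary : ℕ → BitString
toBinary m = reverse (bitsLE (B.fromℕ m))

-- The Look-Knave map k(s) = [|r_1|] ~b_1 ... [|r_t|] ~b_t.
knave : BitString → BitString
knave s = concatMap (λ { (b , n) → toBinary n ++ (not b ∷ []) }) (runs s)

-- s_n for n ≥ 1, indexed so that lk n = s_{n+1}; i.e. lk 0 = s_1 = 1.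
lk : ℕ → BitString
lk zero = true ∷ []
lk (suc n) = knave (lk n)

-- s ℓ = s_ℓ (ℓ ≥ 1; s 0 is unused and set to s_1).
s : ℕ → BitString
s zero = lk zero
s (suc n) = lk n

-- Length of the prefix obtained by taking the first ℓ bits of a string
-- and extending to the end of the maximal run containing the last one:
-- the total length of the runs, in order, up to and including the first
-- run whose end position is ≥ ℓ (the whole string if ℓ exceeds its length).
runPrefixLen : ℕ → List (Bool × ℕ) → ℕ
runPrefixLen ℓ [] = 0
runPrefixLen ℓ ((b , n) ∷ rs) = if ℓ ≤ᵇ n then n else n + runPrefixLen (ℓ Data.Nat.∸ n) rs

r : ℕ → BitString
r ℓ = take (runPrefixLen ℓ (runs (s ℓ))) (s ℓ)

module Submission where

open import Data.Nat using (ℕ; _+_; _≥_)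
open import Data.List using (take; length)
open import Relation.Binary.PropositionalEquality using (_≡_)

open import Defs
open import Data.Bool using (Bool; true; false; not; T; if_then_else_)
open import Data.Empty using (⊥-elim)
open import Data.Nat using (zero; suc; _≤_; _<_; _∸_; _⊓_; _≤ᵇ_; z≤n; s≤s)
open import Data.Nat.Properties
  using (≤-refl; ≤-trans; ≤-reflexive; +-assoc; +-comm; +-identityʳ; +-monoˡ-≤; +-monoʳ-≤;
         m≤n⇒m≤1+n; <⇒≤; ≰⇒>; ≤ᵇ⇒≤; ≤⇒≤ᵇ; m<n⇒0<n∸m; m+[n∸m]≡n; m⊓n≤m; module ≤-Reasoning)
open import Data.Nat.Tactic.RingSolver using (solve-∀)
open import Data.List using (List; []; _∷_; _++_; concatMap; replicate)
open import Data.List.Properties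
  using (length-++; length-replicate; length-take; concatMap-++; ++-assoc; ++-identityʳ)
open import Data.List.Relation.Unary.All using (All; []; _∷_)
open import Data.Maybe using (Maybe; just; nothing; is-just; to-witness-T; _>>=_)
import Data.Maybe as Maybe
open import Data.Product using (Σ; _×_; _,_; proj₂)
open import Data.Sum using (_⊎_; inj₁; inj₂)
open import Relation.Binary.PropositionalEquality
  using (refl; sym; trans; cong; cong₂; subst; subst₂; _≢_; module ≡-Reasoning)

-- We work with run decompositions: `runs w` lists the maximal runs of w, and the
-- Look-Knave map becomes `kn`, which writes [n] followed by the complemented bit for every run.
--  1. Run algebra: the decomposition splits where a 0 is followed by a 1, and expands back.
--  2. Admissibility: every s_n has an admissible run list, i.e. 1-runs of length 1-5, 0-runs of
--     length 1-3, and a single 0 after 11111.  This is a path in a three-state automaton; it is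
--     preserved by the map because the image of each possible block of runs is certified by a
--     finite computation.  Consequently runs have length at most 5, so |r_l| <= l + 4, and the
--     image of an admissible list is at most one bit shorter than the list.
--  3. Shared prefixes: for n >= 14 the run lists of s_{n+1} and s_{n+3} share a prefix A ++ T of
--     at least n + 4 bits, where T ends in a 1-run and the head A is one of two fixed run lists
--     that the map exchanges while gaining 5 bits.  Since T ends in a 1-run the images split at
--     its end; cutting the image of T after its last 1-run loses at most 4 bits, which the head
--     repays, so the invariant passes from n to n + 1.
--  4. The theorem: for l >= 14 the strings agree on n + 4 >= |r_l| bits; for l <= 13 it is
--     checked by evaluation.

Run : Set
Run = Bool × ℕ

consBit : Bool → List Run → List Run
consBit b [] = (b , 1) ∷ []
consBit b ((c , n) ∷ R) = if b ≡ᵇ c then (c , suc n) ∷ R else (b , 1) ∷ (c , n) ∷ R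

runs-∷ : ∀ b w → runs (b ∷ w) ≡ consBit b (runs w)
runs-∷ b w with runs w
... | [] = refl
... | (c , n) ∷ R = refl

consBit-++ : ∀ b X A → X ≢ [] → consBit b (X ++ A) ≡ consBit b X ++ A
consBit-++ b [] A X≢[] = ⊥-elim (X≢[] refl)
consBit-++ b ((c , n) ∷ X) A _ with b ≡ᵇ c
... | true = refl
... | false = refl

consBit≢[] : ∀ b X → consBit b X ≢ []
consBit≢[] b [] ()
consBit≢[] b ((c , n) ∷ X) with b ≡ᵇ c
... | true = λ ()
... | false = λ ()

runs-snoc≢[] : ∀ w b → runs (w ++ b ∷ []) ≢ []
runs-snoc≢[] [] b ()
runs-snoc≢[] (a ∷ w) b eq = consBit≢[] a (runs (w ++ b ∷ [])) (trans (sym (runs-∷ a (w ++ b ∷ []))) eq)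

data StartsWith (c : Bool) : List Run → Set where
  empty : StartsWith c []
  run   : ∀ {n R} → StartsWith c ((c , n) ∷ R)

consBit-fresh : ∀ b X → StartsWith (not b) X → consBit b X ≡ (b , 1) ∷ X
consBit-fresh b     [] empty = refl
consBit-fresh true  _  run   = refl
consBit-fresh false _  run   = refl

runs-split : ∀ w b v → StartsWith (not b) (runs v) →
             runs ((w ++ b ∷ []) ++ v) ≡ runs (w ++ b ∷ []) ++ runs v
runs-split [] b v fresh = trans (runs-∷ b v) (consBit-fresh b (runs v) fresh)
runs-split (a ∷ w) b v fresh = begin
  runs (a ∷ ((w ++ b ∷ []) ++ v))          ≡⟨ runs-∷ a ((w ++ b ∷ []) ++ v) ⟩
  consBit a (runs ((w ++ b ∷ []) ++ v))    ≡⟨ cong (consBit a) (runs-split w b v fresh) ⟩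
  consBit a (runs (w ++ b ∷ []) ++ runs v) ≡⟨ consBit-++ a _ (runs v) (runs-snoc≢[] w b) ⟩
  consBit a (runs (w ++ b ∷ [])) ++ runs v ≡⟨ cong (_++ runs v) (sym (runs-∷ a (w ++ b ∷ []))) ⟩
  runs (a ∷ (w ++ b ∷ [])) ++ runs v       ∎
  where open ≡-Reasoning

consBit-last : ∀ a Z b j → Σ (List Run) λ Z′ → Σ ℕ λ j′ →
               consBit a (Z ++ (b , j) ∷ []) ≡ Z′ ++ (b , j′) ∷ []
consBit-last a [] b j with a ≡ᵇ b
... | true  = [] , suc j , refl
... | false = (a , 1) ∷ [] , j , refl
consBit-last a (z ∷ Z) b j = consBit a (z ∷ Z) , j , consBit-++ a (z ∷ Z) _ (λ ())

runs-last : ∀ w b → Σ (List Run) λ Z → Σ ℕ λ j → runs (w ++ b ∷ []) ≡ Z ++ (b , j) ∷ []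
runs-last [] b = [] , 1 , refl
runs-last (a ∷ w) b with runs-last w b
... | Z , j , eq with consBit-last a Z b j
...   | Z′ , j′ , eq′ = Z′ , j′ , trans (runs-∷ a (w ++ b ∷ [])) (trans (cong (consBit a) eq) eq′)

expand : List Run → BitString
expand [] = []
expand ((b , n) ∷ R) = replicate n b ++ expand R

≡ᵇ-sound : ∀ a c → (a ≡ᵇ c) ≡ true → a ≡ c
≡ᵇ-sound true  true  _ = refl
≡ᵇ-sound false false _ = refl

expand-consBit : ∀ b X → expand (consBit b X) ≡ b ∷ expand X
expand-consBit b [] = refl
expand-consBit b ((c , n) ∷ X) with b ≡ᵇ c in b≡c
... | true rewrite ≡ᵇ-sound b c b≡c = refl
... | false = refl

expand-runs : ∀ w → expand (runs w) ≡ w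
expand-runs [] = refl
expand-runs (b ∷ w) = begin
  expand (runs (b ∷ w))        ≡⟨ cong expand (runs-∷ b w) ⟩
  expand (consBit b (runs w))  ≡⟨ expand-consBit b (runs w) ⟩
  b ∷ expand (runs w)          ≡⟨ cong (b ∷_) (expand-runs w) ⟩
  b ∷ w                        ∎
  where open ≡-Reasoning

expand-++ : ∀ A B → expand (A ++ B) ≡ expand A ++ expand B
expand-++ [] B = refl
expand-++ ((b , n) ∷ A) B =
  trans (cong (replicate n b ++_) (expand-++ A B)) (sym (++-assoc (replicate n b) (expand A) (expand B)))

size : List Run → ℕ
size [] = 0
size ((b , n) ∷ R) = n + size R

size-++ : ∀ A B → size (A ++ B) ≡ size A + size B
size-++ [] B = refl
size-++ ((b , n) ∷ A) B = trans (cong (n +_) (size-++ A B)) (sym (+-assoc n (size A) (size B)))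

length-expand : ∀ R → length (expand R) ≡ size R
length-expand [] = refl
length-expand ((b , n) ∷ R) =
  trans (length-++ (replicate n b)) (cong₂ _+_ (length-replicate n) (length-expand R))

size-runs : ∀ w → size (runs w) ≡ length w
size-runs w = trans (sym (length-expand (runs w))) (cong length (expand-runs w))

-- The Look-Knave map read on run lists: knave w ≡ kn (runs w) by definition.
chunk : Run → BitString
chunk (b , n) = toBinary n ++ (not b ∷ [])

kn : List Run → BitString
kn = concatMap chunk

kn-++ : ∀ A B → kn (A ++ B) ≡ kn A ++ kn B
kn-++ = concatMap-++ chunk

_▹_ : List Run → ℕ → List Run
R ▹ m = R ++ (true , m) ∷ []

kn-▹ : ∀ R m → kn (R ▹ m) ≡ (kn R ++ toBinary m) ++ false ∷ []
kn-▹ R m = begin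
  kn (R ++ (true , m) ∷ [])                  ≡⟨ kn-++ R ((true , m) ∷ []) ⟩
  kn R ++ (toBinary m ++ false ∷ []) ++ []  ≡⟨ cong (kn R ++_) (++-identityʳ _) ⟩
  kn R ++ (toBinary m ++ false ∷ [])        ≡⟨ sym (++-assoc (kn R) (toBinary m) (false ∷ [])) ⟩
  (kn R ++ toBinary m) ++ false ∷ []        ∎
  where open ≡-Reasoning

-- States of the admissibility automaton: the next run is a 1-run of length 1-5 (at1),
-- a 0-run of length 1-3 (at0), or a 0-run of length 1 because 11111 precedes it (at0₁).
data State : Set where
  at1 at0 at0₁ : State

data Expects0 : State → Set where
  at0  : Expects0 at0
  at0₁ : Expects0 at0₁

data OneRun : ℕ → State → Set where
  1¹ : OneRun 1 at0
  1² : OneRun 2 at0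
  1³ : OneRun 3 at0
  1⁴ : OneRun 4 at0
  1⁵ : OneRun 5 at0₁

data ZeroRun : State → ℕ → Set where
  0¹ : ∀ {s} → Expects0 s → ZeroRun s 1
  0² : ZeroRun at0 2
  0³ : ZeroRun at0 3

data Step : State → Run → State → Set where
  ones  : ∀ {n t} → OneRun n t → Step at1 (true , n) t
  zeros : ∀ {s n} → ZeroRun s n → Step s (false , n) at1

data Path : State → List Run → State → Set where
  []  : ∀ {s} → Path s [] s
  _∷_ : ∀ {s x t R u} → Step s x t → Path t R u → Path s (x ∷ R) u

Admissible : List Run → Set
Admissible R = Σ State (Path at1 R)

path-++ : ∀ {s Z t X u} → Path s Z t → Path t X u → Path s (Z ++ X) u
path-++ [] q = q
path-++ (x ∷ p) q = x ∷ path-++ p q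

path-split : ∀ {s X u} Z → Path s (Z ++ X) u → Σ State λ t → Path s Z t × Path t X u
path-split [] p = _ , [] , p
path-split (z ∷ Z) (x ∷ p) with path-split Z p
... | t , p₁ , p₂ = t , x ∷ p₁ , p₂

path-starts : ∀ {R u} → Path at1 R u → StartsWith true R
path-starts [] = empty
path-starts (ones _ ∷ _) = run
path-starts (zeros (0¹ ()) ∷ _)

-- A semi-decision procedure for paths; `certified` turns a successful run of it on a
-- concrete run list into a proof.
step? : (s : State) (x : Run) → Maybe (Σ State (Step s x))
step? at1 (true , 1) = just (_ , ones 1¹)
step? at1 (true , 2) = just (_ , ones 1²)
step? at1 (true , 3) = just (_ , ones 1³)
step? at1 (true , 4) = just (_ , ones 1⁴)
step? at1 (true , 5) = just (_ , ones 1⁵)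
step? at0 (false , 1) = just (_ , zeros (0¹ at0))
step? at0₁ (false , 1) = just (_ , zeros (0¹ at0₁))
step? at0 (false , 2) = just (_ , zeros 0²)
step? at0 (false , 3) = just (_ , zeros 0³)
step? _ _ = nothing

same? : (s t : State) → Maybe (s ≡ t)
same? at1 at1 = just refl
same? at0 at0 = just refl
same? at0₁ at0₁ = just refl
same? _ _ = nothing

path? : (s : State) (R : List Run) (t : State) → Maybe (Path s R t)
path? s [] t = Maybe.map (λ { refl → [] }) (same? s t)
path? s (x ∷ R) t = step? s x >>= λ { (u , st) → Maybe.map (st ∷_) (path? u R t) }

certified : (s : State) (R : List Run) (t : State) → {T (is-just (path? s R t))} → Path s R t
certified s R t {found} = to-witness-T (path? s R t) found

-- A block w ++ 0 whose runs form a loop at at1 can be put in front of an admissible image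
-- (which starts with a 1, so the runs split between them).
glue : ∀ w {K} → Path at1 (runs (w ++ false ∷ [])) at1 → Admissible (runs K) →
       Admissible (runs ((w ++ false ∷ []) ++ K))
glue w {K} block (u , p) =
  u , subst (λ R → Path at1 R u) (sym (runs-split w false K (path-starts p))) (path-++ block p)

leadBlock : ∀ {n t} → OneRun n t → Path at1 (runs (chunk (true , n))) at1
leadBlock 1¹ = certified _ _ _
leadBlock 1² = certified _ _ _
leadBlock 1³ = certified _ _ _
leadBlock 1⁴ = certified _ _ _
leadBlock 1⁵ = certified _ _ _

pairBlock : ∀ {s a b t} → ZeroRun s a → OneRun b t →
            Path at1 (runs ((chunk (false , a) ++ toBinary b) ++ false ∷ [])) at1
pairBlock (0¹ _) 1¹ = certified _ _ _
pairBlock (0¹ _) 1² = certified _ _ _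
pairBlock (0¹ _) 1³ = certified _ _ _
pairBlock (0¹ _) 1⁴ = certified _ _ _
pairBlock (0¹ _) 1⁵ = certified _ _ _
pairBlock 0² 1¹ = certified _ _ _
pairBlock 0² 1² = certified _ _ _
pairBlock 0² 1³ = certified _ _ _
pairBlock 0² 1⁴ = certified _ _ _
pairBlock 0² 1⁵ = certified _ _ _
pairBlock 0³ 1¹ = certified _ _ _
pairBlock 0³ 1² = certified _ _ _
pairBlock 0³ 1³ = certified _ _ _
pairBlock 0³ 1⁴ = certified _ _ _
pairBlock 0³ 1⁵ = certified _ _ _

lastBlock : ∀ {s a} → ZeroRun s a → Path at1 (runs (kn ((false , a) ∷ []))) at0
lastBlock (0¹ _) = certified _ _ _
lastBlock 0² = certified _ _ _
lastBlock 0³ = certified _ _ _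

kn-pair : ∀ a b R → kn ((false , a) ∷ (true , b) ∷ R) ≡
          ((chunk (false , a) ++ toBinary b) ++ false ∷ []) ++ kn R
kn-pair a b R = sym (begin
  ((c₀ ++ toBinary b) ++ false ∷ []) ++ kn R  ≡⟨ ++-assoc (c₀ ++ toBinary b) (false ∷ []) (kn R) ⟩
  (c₀ ++ toBinary b) ++ false ∷ kn R           ≡⟨ ++-assoc c₀ (toBinary b) (false ∷ kn R) ⟩
  c₀ ++ (toBinary b ++ false ∷ kn R)           ≡⟨ cong (c₀ ++_) (sym (++-assoc (toBinary b) (false ∷ []) (kn R))) ⟩
  c₀ ++ ((toBinary b ++ false ∷ []) ++ kn R)   ∎)
  where
  open ≡-Reasoning
  c₀ = chunk (false , a)

-- The Look-Knave map preserves admissibility: read the list as a leading 1-run or a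
-- (0-run, 1-run) pair followed by the rest, or a final 0-run.
image : ∀ {s R t} → Path s R t → Admissible (runs (kn R))
image [] = _ , []
image (ones {n} o ∷ p) = glue (toBinary n) (leadBlock o) (image p)
image (zeros z ∷ []) = _ , lastBlock z
image {R = (false , a) ∷ (true , b) ∷ R} (zeros z ∷ ones o ∷ p) =
  subst (λ w → Admissible (runs w)) (sym (kn-pair a b R))
    (glue (chunk (false , a) ++ toBinary b) (pairBlock z o) (image p))
image (zeros z ∷ zeros (0¹ ()) ∷ p)

lkRuns : ℕ → List Run
lkRuns n = runs (lk n)

lkRuns-admissible : ∀ n → Admissible (lkRuns n)
lkRuns-admissible zero = _ , ones 1¹ ∷ []
lkRuns-admissible (suc n) = image (proj₂ (lkRuns-admissible n))

last-run : ∀ {s Z u} → Path s Z u → Expects0 u →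
           Z ≡ [] ⊎ Σ (List Run) λ Z₀ → Σ ℕ λ k → Z ≡ Z₀ ▹ k
last-run [] e = inj₁ refl
last-run (ones {n} o ∷ []) e = inj₂ ([] , n , refl)
last-run (zeros z ∷ []) ()
last-run {Z = x ∷ _} (_ ∷ p@(_ ∷ _)) e with last-run p e
... | inj₂ (Z₀ , k , eq) = inj₂ (x ∷ Z₀ , k , cong (x ∷_) eq)
... | inj₁ ()

ends-in-1 : ∀ {Z u} → Path at1 Z u → Expects0 u → Σ (List Run) λ Z₀ → Σ ℕ λ k → Z ≡ Z₀ ▹ k
ends-in-1 p e with last-run p e
ends-in-1 [] () | inj₁ refl
... | inj₂ found = found

zeroRun-expects0 : ∀ {s n} → ZeroRun s n → Expects0 s
zeroRun-expects0 (0¹ e) = e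
zeroRun-expects0 0² = at0
zeroRun-expects0 0³ = at0

zeroRun≤3 : ∀ {s n} → ZeroRun s n → n ≤ 3
zeroRun≤3 (0¹ _) = s≤s z≤n
zeroRun≤3 0² = s≤s (s≤s z≤n)
zeroRun≤3 0³ = ≤-refl

image-last : ∀ {s P m t} → Path s (P ▹ m) t →
  Σ (List Run) λ Z₀ → Σ ℕ λ k → Σ ℕ λ j → runs (kn (P ▹ m)) ≡ (Z₀ ▹ k) ++ (false , j) ∷ [] × j ≤ 3
image-last {P = P} {m} p with runs-last (kn P ++ toBinary m) false
... | Z , j , eq with image p
...   | u , q with path-split Z (subst (λ R → Path at1 R u) (trans (cong runs (kn-▹ P m)) eq) q)
...     | _ , q₁ , zeros z ∷ [] with ends-in-1 q₁ (zeroRun-expects0 z)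
...       | Z₀ , k , refl = Z₀ , k , j , trans (cong runs (kn-▹ P m)) eq , zeroRun≤3 z

step≤5 : ∀ {s b n t} → Step s (b , n) t → n ≤ 5
step≤5 (ones 1¹) = s≤s z≤n
step≤5 (ones 1²) = s≤s (s≤s z≤n)
step≤5 (ones 1³) = s≤s (s≤s (s≤s z≤n))
step≤5 (ones 1⁴) = s≤s (s≤s (s≤s (s≤s z≤n)))
step≤5 (ones 1⁵) = ≤-refl
step≤5 (zeros z) = ≤-trans (zeroRun≤3 z) (s≤s (s≤s (s≤s z≤n)))

path-runs≤5 : ∀ {s R t} → Path s R t → All (λ x → proj₂ x ≤ 5) R
path-runs≤5 [] = []
path-runs≤5 (x ∷ p) = step≤5 x ∷ path-runs≤5 p

runPrefixLen-≤ : ∀ c ℓ R → All (λ x → proj₂ x ≤ suc c) R → 1 ≤ ℓ → runPrefixLen ℓ R ≤ ℓ + c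
runPrefixLen-≤ c ℓ [] _ _ = z≤n
runPrefixLen-≤ c ℓ ((b , n) ∷ R) (n≤1+c ∷ bounded) 1≤ℓ with ℓ ≤ᵇ n in ℓ≤ᵇn
... | true = ≤-trans n≤1+c (+-monoˡ-≤ c 1≤ℓ)
... | false = begin
    n + runPrefixLen (ℓ ∸ n) R ≤⟨ +-monoʳ-≤ n (runPrefixLen-≤ c (ℓ ∸ n) R bounded (m<n⇒0<n∸m n<ℓ)) ⟩
    n + ((ℓ ∸ n) + c)         ≡⟨ sym (+-assoc n (ℓ ∸ n) c) ⟩
    (n + (ℓ ∸ n)) + c         ≡⟨ cong (_+ c) (m+[n∸m]≡n (<⇒≤ n<ℓ)) ⟩
    ℓ + c                     ∎
  where
  open ≤-Reasoning
  n<ℓ : n < ℓ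
  n<ℓ = ≰⇒> (λ ℓ≤n → subst T ℓ≤ᵇn (≤⇒≤ᵇ ℓ≤n))

-- |r ℓ| ≤ ℓ + 4, since every run of s_ℓ has length at most 5.
r-length : ∀ n → length (r (suc n)) ≤ suc n + 4
r-length n = begin
  length (take k (lk n))   ≡⟨ length-take k (lk n) ⟩
  k ⊓ length (lk n)        ≤⟨ m⊓n≤m k (length (lk n)) ⟩
  k                        ≤⟨ runPrefixLen-≤ 4 (suc n) (lkRuns n) (path-runs≤5 (proj₂ (lkRuns-admissible n))) (s≤s z≤n) ⟩
  suc n + 4                ∎
  where
  open ≤-Reasoning
  k = runPrefixLen (suc n) (lkRuns n)

-- The image of an admissible list is at most one bit shorter than the list:
-- only 11111 shrinks (to 1010), and the 0 that must follow it grows (to 11).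
gain : ∀ {s T t} → Path s T t → size T ≤ length (kn T) + 1
gain [] = z≤n
gain (ones 1¹ ∷ p) = s≤s (m≤n⇒m≤1+n (gain p))
gain (ones 1² ∷ p) = s≤s (s≤s (m≤n⇒m≤1+n (gain p)))
gain (ones 1³ ∷ p) = s≤s (s≤s (s≤s (gain p)))
gain (ones 1⁴ ∷ p) = s≤s (s≤s (s≤s (s≤s (gain p))))
gain (ones 1⁵ ∷ []) = ≤-refl
gain (ones 1⁵ ∷ zeros (0¹ at0₁) ∷ p) = +-monoʳ-≤ 6 (gain p)
gain (zeros (0¹ _) ∷ p) = s≤s (m≤n⇒m≤1+n (gain p))
gain (zeros 0² ∷ p) = s≤s (s≤s (m≤n⇒m≤1+n (gain p)))
gain (zeros 0³ ∷ p) = s≤s (s≤s (s≤s (gain p)))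

-- The image of a prefix ending in a 1-run ends in 0, while the image of an admissible
-- suffix starts with 1, so the run list of the image splits there.
runs-kn-▹ : ∀ P m X {s u} → Path s X u →
            runs (kn ((P ▹ m) ++ X)) ≡ runs (kn (P ▹ m)) ++ runs (kn X)
runs-kn-▹ P m X p = begin
  runs (kn ((P ▹ m) ++ X))                           ≡⟨ cong runs (kn-++ (P ▹ m) X) ⟩
  runs (kn (P ▹ m) ++ kn X)                          ≡⟨ cong (λ w → runs (w ++ kn X)) (kn-▹ P m) ⟩
  runs (((kn P ++ toBinary m) ++ false ∷ []) ++ kn X) ≡⟨ runs-split (kn P ++ toBinary m) false (kn X) (path-starts (proj₂ (image p))) ⟩
  runs ((kn P ++ toBinary m) ++ false ∷ []) ++ runs (kn X) ≡⟨ cong (λ w → runs w ++ runs (kn X)) (sym (kn-▹ P m)) ⟩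
  runs (kn (P ▹ m)) ++ runs (kn X)                   ∎
  where open ≡-Reasoning

-- `SharesPrefix A n`: the run lists of lk n and lk (2 + n) share the prefix A ++ (T₀ ▹ m),
-- a fixed head A followed by a tail ending in a 1-run, covering at least n + 4 bits.
record SharesPrefix (A : List Run) (n : ℕ) : Set where
  constructor shares
  field
    T₀     : List Run
    m      : ℕ
    X Y    : List Run
    at-n   : lkRuns n ≡ A ++ ((T₀ ▹ m) ++ X)
    at-n+2 : lkRuns (2 + n) ≡ A ++ ((T₀ ▹ m) ++ Y)
    long   : n + 4 ≤ size A + size (T₀ ▹ m)

regroup : ∀ A′ U Z₀ k j R → (A′ ++ U) ++ (((Z₀ ▹ k) ++ (false , j) ∷ []) ++ R) ≡
                            A′ ++ (((U ++ Z₀) ▹ k) ++ (false , j) ∷ R)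
regroup (x ∷ A′) U Z₀ k j R = cong (x ∷_) (regroup A′ U Z₀ k j R)
regroup [] (x ∷ U) Z₀ k j R = cong (x ∷_) (regroup [] U Z₀ k j R)
regroup [] [] (x ∷ Z₀) k j R = cong (x ∷_) (regroup [] [] Z₀ k j R)
regroup [] [] [] k j R = refl

-- The bit budget of one step: the head gains at least 5 bits, the tail loses at most 1
-- (by `gain`) plus the final 0-run of length j ≤ 3 that is cut off.
budget : ∀ n a t w z j a′ u → n + 4 ≤ a + t → t ≤ w + 1 → w ≡ z + j → j ≤ 3 →
         a + 5 ≤ a′ + u → suc n + 4 ≤ a′ + (u + z)
budget n a t w z j a′ u long t≤w+1 w≡z+j j≤3 head-gain = begin
  suc (n + 4)              ≤⟨ s≤s long ⟩
  suc (a + t)              ≤⟨ s≤s (+-monoʳ-≤ a t≤w+1) ⟩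
  suc (a + (w + 1))        ≡⟨ cong (λ v → suc (a + (v + 1))) w≡z+j ⟩
  suc (a + ((z + j) + 1))  ≤⟨ s≤s (+-monoʳ-≤ a (+-monoˡ-≤ 1 (+-monoʳ-≤ z j≤3))) ⟩
  suc (a + ((z + 3) + 1))  ≡⟨ rearrange a z ⟩
  (a + 5) + z              ≤⟨ +-monoˡ-≤ z head-gain ⟩
  (a′ + u) + z             ≡⟨ +-assoc a′ u z ⟩
  a′ + (u + z)             ∎
  where
  open ≤-Reasoning
  rearrange : ∀ a z → suc (a + ((z + 3) + 1)) ≡ (a + 5) + z
  rearrange = solve-∀

middle : ∀ P Q R {s u} → Path s (P ++ (Q ++ R)) u →
         Σ State λ t → Σ State λ t′ → Path t Q t′ × Path t′ R u
middle P Q R p with path-split P p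
... | t , _ , q with path-split Q q
...   | t′ , q₁ , q₂ = t , t′ , q₁ , q₂

runs-kn-▹▹ : ∀ A₀ a T₀ m V {s u} → Path s ((A₀ ▹ a) ++ ((T₀ ▹ m) ++ V)) u →
  runs (kn ((A₀ ▹ a) ++ ((T₀ ▹ m) ++ V))) ≡ runs (kn (A₀ ▹ a)) ++ (runs (kn (T₀ ▹ m)) ++ runs (kn V))
runs-kn-▹▹ A₀ a T₀ m V p with path-split (A₀ ▹ a) p
... | _ , _ , q with path-split (T₀ ▹ m) q
...   | _ , _ , qV =
  trans (runs-kn-▹ A₀ a ((T₀ ▹ m) ++ V) q) (cong (runs (kn (A₀ ▹ a)) ++_) (runs-kn-▹ T₀ m V qV))

module _ (A₀ : List Run) (a : ℕ) (A′ U : List Run)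
         (head-image : runs (kn (A₀ ▹ a)) ≡ A′ ++ U)
         (head-gain : size (A₀ ▹ a) + 5 ≤ size A′ + size U) where

  shares-step : ∀ {n} → SharesPrefix (A₀ ▹ a) n → SharesPrefix A′ (suc n)
  shares-step {n} (shares T₀ m X Y at-n at-n+2 long)
    with middle (A₀ ▹ a) (T₀ ▹ m) X (proj₂ (subst Admissible at-n (lkRuns-admissible n)))
  ... | _ , _ , tail-path , _ with image-last tail-path
  ... | Z₀ , k , j , tail-image , j≤3 =
    shares (U ++ Z₀) k _ _ (image-at n X at-n) (image-at (2 + n) Y at-n+2) long′
    where
    open ≡-Reasoning
    A = A₀ ▹ a
    Tail = T₀ ▹ m

    image-at : ∀ i V → lkRuns i ≡ A ++ (Tail ++ V) →
               lkRuns (suc i) ≡ A′ ++ (((U ++ Z₀) ▹ k) ++ (false , j) ∷ runs (kn V))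
    image-at i V eq = begin
      runs (kn (lkRuns i))                                 ≡⟨ cong (λ R → runs (kn R)) eq ⟩
      runs (kn (A ++ (Tail ++ V)))                           ≡⟨ runs-kn-▹▹ A₀ a T₀ m V (proj₂ (subst Admissible eq (lkRuns-admissible i))) ⟩
      runs (kn A) ++ (runs (kn Tail) ++ runs (kn V))         ≡⟨ cong₂ (λ P Q → P ++ (Q ++ runs (kn V))) head-image tail-image ⟩
      (A′ ++ U) ++ (((Z₀ ▹ k) ++ (false , j) ∷ []) ++ runs (kn V)) ≡⟨ regroup A′ U Z₀ k j (runs (kn V)) ⟩
      A′ ++ (((U ++ Z₀) ▹ k) ++ (false , j) ∷ runs (kn V)) ∎

    image-size : length (kn Tail) ≡ size (Z₀ ▹ k) + j
    image-size = begin
      length (kn Tail)                          ≡⟨ sym (size-runs (kn Tail)) ⟩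
      size (runs (kn Tail))                     ≡⟨ cong size tail-image ⟩
      size ((Z₀ ▹ k) ++ (false , j) ∷ [])     ≡⟨ size-++ (Z₀ ▹ k) _ ⟩
      size (Z₀ ▹ k) + (j + 0)                 ≡⟨ cong (size (Z₀ ▹ k) +_) (+-identityʳ j) ⟩
      size (Z₀ ▹ k) + j                       ∎

    new-size : size ((U ++ Z₀) ▹ k) ≡ size U + size (Z₀ ▹ k)
    new-size = trans (cong size (++-assoc U Z₀ _)) (size-++ U (Z₀ ▹ k))

    long′ : suc n + 4 ≤ size A′ + size ((U ++ Z₀) ▹ k)
    long′ = subst (λ v → suc n + 4 ≤ size A′ + v) (sym new-size)
      (budget n (size A) (size Tail) (length (kn Tail)) (size (Z₀ ▹ k)) j (size A′) (size U)
              long (gain tail-path) image-size j≤3 head-gain)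

1ʳ 0ʳ : ℕ → Run
1ʳ n = true , n
0ʳ n = false , n

-- Two heads that the Look-Knave map exchanges while gaining at least 5 bits: seed true
-- consists of the first 15 runs of s₁₅, seed false of the first 15 runs of s₁₆.
seedBody : Bool → List Run
seedBody true  = 1ʳ 1 ∷ 0ʳ 1 ∷ 1ʳ 4 ∷ 0ʳ 1 ∷ 1ʳ 5 ∷ 0ʳ 1 ∷ 1ʳ 3 ∷ 0ʳ 1 ∷ 1ʳ 3 ∷ 0ʳ 3 ∷ 1ʳ 3 ∷ 0ʳ 3 ∷ 1ʳ 3 ∷ 0ʳ 1 ∷ []
seedBody false = 1ʳ 1 ∷ 0ʳ 1 ∷ 1ʳ 3 ∷ 0ʳ 3 ∷ 1ʳ 3 ∷ 0ʳ 1 ∷ 1ʳ 1 ∷ 0ʳ 1 ∷ 1ʳ 4 ∷ 0ʳ 1 ∷ 1ʳ 4 ∷ 0ʳ 1 ∷ 1ʳ 5 ∷ 0ʳ 1 ∷ []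

seedLast : Bool → ℕ
seedLast true  = 1
seedLast false = 5

seed : Bool → List Run
seed b = seedBody b ▹ seedLast b

seed-image : ∀ b → Σ (List Run) λ U →
  runs (kn (seed b)) ≡ seed (not b) ++ U × size (seed b) + 5 ≤ size (seed (not b)) + size U
seed-image true  = _ , refl , ≤ᵇ⇒≤ _ _ _
seed-image false = _ , refl , ≤ᵇ⇒≤ _ _ _

seed-step : ∀ b {n} → SharesPrefix (seed b) n → SharesPrefix (seed (not b)) (suc n)
seed-step b with seed-image b
... | U , image , gain₅ = shares-step (seedBody b) (seedLast b) (seed (not b)) U image gain₅

shares-from-14 : ∀ k → Σ Bool λ b → SharesPrefix (seed b) (14 + k)
shares-from-14 zero = true , shares (0ʳ 1 ∷ 1ʳ 3 ∷ 0ʳ 1 ∷ []) 1 _ _ refl refl (≤ᵇ⇒≤ _ _ _)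
shares-from-14 (suc k) with shares-from-14 k
... | b , shared = not b , seed-step b shared

take-++ : ∀ {A : Set} k (P Q : List A) → k ≤ length P → take k (P ++ Q) ≡ take k P
take-++ zero P Q _ = refl
take-++ (suc k) (x ∷ P) Q (s≤s k≤|P|) = cong (x ∷_) (take-++ k P Q k≤|P|)

lk-expand : ∀ n P X → lkRuns n ≡ P ++ X → lk n ≡ expand P ++ expand X
lk-expand n P X eq = trans (sym (expand-runs (lk n))) (trans (cong expand eq) (expand-++ P X))

agree : ∀ {A n} → SharesPrefix A n → ∀ k → k ≤ n + 4 → take k (lk n) ≡ take k (lk (2 + n))
agree {A} {n} (shares T₀ m X Y at-n at-n+2 long) k k≤n+4 = begin
  take k (lk n)                                   ≡⟨ cong (take k) (lk-expand n P X (trans at-n (sym (++-assoc A Tail X)))) ⟩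
  take k (expand P ++ expand X)                   ≡⟨ take-++ k (expand P) (expand X) k≤|P| ⟩
  take k (expand P)                               ≡⟨ sym (take-++ k (expand P) (expand Y) k≤|P|) ⟩
  take k (expand P ++ expand Y)                   ≡⟨ sym (cong (take k) (lk-expand (2 + n) P Y (trans at-n+2 (sym (++-assoc A Tail Y))))) ⟩
  take k (lk (2 + n))                             ∎
  where
  open ≡-Reasoning
  Tail = T₀ ▹ m
  P = A ++ Tail
  k≤|P| : k ≤ length (expand P)
  k≤|P| = ≤-trans k≤n+4 (≤-trans long (≤-reflexive (sym (trans (length-expand P) (size-++ A Tail)))))

from-14 : ∀ k → let ℓ = 14 + k in
          take (length (r ℓ)) (s (ℓ + 1)) ≡ take (length (r ℓ)) (s (ℓ + 3))
from-14 k = subst₂ (λ i j → take ρ (lk i) ≡ take ρ (lk j))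
                   (cong (13 +_) (+-comm 1 k)) (cong (13 +_) (+-comm 3 k))
                   (agree (proj₂ (shares-from-14 k)) ρ (r-length (13 + k)))
  where ρ = length (r (14 + k))

lemma2 : (ℓ : ℕ) → ℓ ≥ 1 →
    take (length (r ℓ)) (s (ℓ + 1)) ≡ take (length (r ℓ)) (s (ℓ + 3))
lemma2 zero ()
lemma2 1 _ = refl
lemma2 2 _ = refl
lemma2 3 _ = refl
lemma2 4 _ = refl
lemma2 5 _ = refl
lemma2 6 _ = refl
lemma2 7 _ = refl
lemma2 8 _ = refl
lemma2 9 _ = refl
lemma2 10 _ = refl
lemma2 11 _ = refl
lemma2 12 _ = refl
lemma2 13 _ = refl
lemma2 (suc (suc (suc (suc (suc (suc (suc (suc (suc (suc (suc (suc (suc (suc k)))))))))))))) _ = from-14 k
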